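{- Let $n\ge 1$ and let $f$ be a crooked function over $\mathbb F_{2^n}$. Identify $\mathrm{PG}(n,2)$ with the nonzero vectors of $\mathbb F_{2^n}\times\mathbb F_2$, and define $c_f:(\mathbb F_{2^n}\times\mathbb F_2)\times(\mathbb F_{2^n}\times\mathbb F_2)\to\mathbb F_{2^n}$ by $$c_f((x,x_1),(y,y_1))=f(x+y)+f(x)+f(y)+f(x_1y+y_1x).$$ For a line $\ell=\{u,v,u+v\}$ of $\mathrm{PG}(n,2)$ set $c_f(\ell)=c_f(u,v)$ (this value lies in $\mathbb F_{2^n}^*$ and does not depend on the choice of two points of $\ell$). Then for each $c\in\mathbb F_{2^n}^*$ the set of lines $\ell$ with $c_f(\ell)=c$ is a line-spread of $\mathrm{PG}(n,2)$, these spreads are pairwise disjoint, and together they form a line-parallelism $\Pi_f$ of $\mathrm{PG}(n,2)$.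
   Context: A function $f:\mathbb F_{2^n}\to\mathbb F_{2^n}$ is crooked if (1) $f(0)=0$; (2) $f(x)+f(y)+f(z)+f(x+y+z)\neq 0$ for any three distinct $x,y,z\in\mathbb F_{2^n}$; (3) $f(x)+f(y)+f(z)+f(x+a)+f(y+a)+f(z+a)\ne 0$ for any $a\neq 0$ and any $x,y,z\in\mathbb F_{2^n}$. $\mathrm{PG}(n,2)$ is the projective space whose points are the nonzero vectors of $\mathbb F_2^{n+1}\cong\mathbb F_{2^n}\times\mathbb F_2$ and whose lines are the sets $\{u,v,u+v\}$ for distinct nonzero $u,v$. A line-spread is a set of lines partitioning the point set; a line-parallelism is a partition of the set of all lines into line-spreads. -}

module Defs where

open import Data.Nat using (ℕ)
open import Data.Bool using (Bool; true; false; _xor_; if_then_else_)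
open import Data.Vec using (Vec; zipWith; replicate)
open import Data.Product using (_×_; _,_; Σ; ∃)
open import Data.Sum using (_⊎_)
open import Relation.Binary.PropositionalEquality using (_≡_; _≢_)
open import Function.Bundles using (_⇔_)
open import Data.Empty using (⊥)

-- Additive group of F_{2^n}, identified with F_2^n (only addition of
-- F_{2^n} enters the statement).
F : ℕ → Set
F n = Vec Bool n

_⊕_ : {n : ℕ} → F n → F n → F n
_⊕_ = zipWith _xor_
infixl 6 _⊕_

𝟘 : {n : ℕ} → F n
𝟘 = replicate _ false

_·_ : {n : ℕ} → Bool → F n → F n
b · x = if b then x else 𝟘
infixl 7 _·_

Crooked : {n : ℕ} → (F n → F n) → Set
Crooked {n} f =
  (f 𝟘 ≡ 𝟘)
  × ((x y z : F n) → x ≢ y → x ≢ z → y ≢ z →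
       f x ⊕ f y ⊕ f z ⊕ f (x ⊕ y ⊕ z) ≢ 𝟘)
  × ((a x y z : F n) → a ≢ 𝟘 →
       f x ⊕ f y ⊕ f z ⊕ f (x ⊕ a) ⊕ f (y ⊕ a) ⊕ f (z ⊕ a) ≢ 𝟘)

W : ℕ → Set
W n = F n × Bool

_+W_ : {n : ℕ} → W n → W n → W n
(x , a) +W (y , b) = (x ⊕ y , a xor b)

𝟘W : {n : ℕ} → W n
𝟘W = (𝟘 , false)

IsPoint : {n : ℕ} → W n → Set
IsPoint p = p ≢ 𝟘W

-- a line {u, v, u+v}, given by two distinct points
record Line (n : ℕ) : Set where
  constructor line
  field
    u v   : W n
    u≢0   : u ≢ 𝟘W
    v≢0   : v ≢ 𝟘W
    u≢v   : u ≢ v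
open Line public

_∈L_ : {n : ℕ} → W n → Line n → Set
p ∈L ℓ = (p ≡ u ℓ) ⊎ (p ≡ v ℓ) ⊎ (p ≡ u ℓ +W v ℓ)

SameLine : {n : ℕ} → Line n → Line n → Set
SameLine {n} ℓ ℓ' = (p : W n) → (p ∈L ℓ) ⇔ (p ∈L ℓ')

cf : {n : ℕ} → (F n → F n) → W n → W n → F n
cf f (x , x₁) (y , y₁) = f (x ⊕ y) ⊕ f x ⊕ f y ⊕ f (x₁ · y ⊕ y₁ · x)

cfL : {n : ℕ} → (F n → F n) → Line n → F n
cfL f ℓ = cf f (u ℓ) (v ℓ)

IsLineSpread : {n : ℕ} → (Line n → Set) → Set
IsLineSpread {n} S =
  ((p : W n) → IsPoint p → Σ (Line n) (λ ℓ → S ℓ × p ∈L ℓ))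
  × ((ℓ ℓ' : Line n) → S ℓ → S ℓ' → (p : W n) → p ∈L ℓ → p ∈L ℓ' → SameLine ℓ ℓ')

IsLineParallelism : {n : ℕ} → (F n → Line n → Set) → Set
IsLineParallelism {n} S =
  ((c : F n) → c ≢ 𝟘 → IsLineSpread (S c))
  × ((c c' : F n) → c ≢ 𝟘 → c' ≢ 𝟘 → c ≢ c' → (ℓ : Line n) → S c ℓ → S c' ℓ → ⊥)
  × ((ℓ : Line n) → Σ (F n) (λ c → c ≢ 𝟘 × S c ℓ))

Πf : {n : ℕ} → (F n → F n) → F n → Line n → Set
Πf f c ℓ = cfL f ℓ ≡ c

-- Fix a point p of PG(n,2). Up to the swap q ↦ p + q, which preserves the line
-- {p, q, p + q}, the map q ↦ c_f(p, q) is injective: for p = (x, 1) it is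
-- f x + f (the first coordinate of whichever of q, p + q ends in 1), and f is
-- injective; for p = (x, 0) the two crookedness conditions say that the
-- derivative y ↦ f y + f (y + x) is 2-to-1 and that three of its values never sum
-- to zero. Hence the lines through p with a given value c are all the same line,
-- and c_f(p, -) restricted to a transversal of the pairs {q, p + q} is an
-- injective, hence bijective, map of F_{2^n}, so every c ≠ 0 is attained.
module Submission where

open import Defs
open import Data.Nat using (ℕ; zero; suc; _+_; _≤_; _^_)
open import Data.Nat.Properties using (1+n≰n)
open import Data.Bool using (Bool; true; false; not; _xor_; if_then_else_)
import Data.Bool as Bool
open import Data.Bool.Properties using (xor-comm; xor-assoc; xor-identityˡ; xor-identityʳ; xor-same; not-¬)
open import Data.Vec using (Vec; []; _∷_; lookup)
open import Data.Vec.Properties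
  using (≡-dec; zipWith-comm; zipWith-assoc; zipWith-identityˡ; zipWith-identityʳ; lookup-zipWith)
open import Data.Vec.Recursive using (lift↔; Fin[m^n]↔Fin[m]^n)
open import Data.Vec.Recursive.Properties using (↔Vec)
open import Data.Fin using (Fin; zero; suc; punchOut)
import Data.Fin as Fin
open import Data.Fin.Properties using (2↔Bool; any?; punchOut-injective; injective⇒≤)
open import Data.Product using (_×_; _,_; Σ; ∃; proj₁; proj₂)
open import Data.Sum using (_⊎_; inj₁; inj₂)
open import Data.Empty using (⊥; ⊥-elim)
open import Function using (_∘_)
open import Function.Bundles using (_⇔_; mk⇔; Equivalence; _↔_; Inverse)
open import Function.Definitions using (Injective)
import Function.Properties.Equivalence as ⇔
open import Function.Properties.Inverse using (↔-sym; ↔-trans)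
open import Relation.Binary.Definitions using (DecidableEquality)
open import Relation.Nullary using (yes; no; contradiction)
open import Relation.Binary.PropositionalEquality
open ≡-Reasoning

private
  variable
    k n N : ℕ
    A : Set

⊕-comm : (x y : F n) → x ⊕ y ≡ y ⊕ x
⊕-comm = zipWith-comm xor-comm

⊕-assoc : (x y z : F n) → (x ⊕ y) ⊕ z ≡ x ⊕ (y ⊕ z)
⊕-assoc = zipWith-assoc xor-assoc

⊕-identityˡ : (x : F n) → 𝟘 ⊕ x ≡ x
⊕-identityˡ = zipWith-identityˡ xor-identityˡ

⊕-identityʳ : (x : F n) → x ⊕ 𝟘 ≡ x
⊕-identityʳ = zipWith-identityʳ xor-identityʳ

⊕-self : (x : F n) → x ⊕ x ≡ 𝟘
⊕-self []      = refl
⊕-self (b ∷ x) = cong₂ _∷_ (xor-same b) (⊕-self x)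

⊕-interchange : (w x y z : F n) → (w ⊕ x) ⊕ (y ⊕ z) ≡ (w ⊕ y) ⊕ (x ⊕ z)
⊕-interchange w x y z = begin
  (w ⊕ x) ⊕ (y ⊕ z)  ≡⟨ ⊕-assoc w x (y ⊕ z) ⟩
  w ⊕ (x ⊕ (y ⊕ z))  ≡⟨ cong (w ⊕_) (sym (⊕-assoc x y z)) ⟩
  w ⊕ ((x ⊕ y) ⊕ z)  ≡⟨ cong (λ t → w ⊕ (t ⊕ z)) (⊕-comm x y) ⟩
  w ⊕ ((y ⊕ x) ⊕ z)  ≡⟨ cong (w ⊕_) (⊕-assoc y x z) ⟩
  w ⊕ (y ⊕ (x ⊕ z))  ≡⟨ sym (⊕-assoc w y (x ⊕ z)) ⟩
  (w ⊕ y) ⊕ (x ⊕ z)  ∎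

·-distribʳ-xor : (b c : Bool) (x : F n) → (b xor c) · x ≡ b · x ⊕ c · x
·-distribʳ-xor true  true  x = sym (⊕-self x)
·-distribʳ-xor true  false x = sym (⊕-identityʳ x)
·-distribʳ-xor false c     x = sym (⊕-identityˡ (c · x))

infix 4 _≟_
_≟_ : DecidableEquality (F n)
_≟_ = ≡-dec Bool._≟_

module ⊕-Solver where

  infixl 6 _⊞_
  data Expr (k : ℕ) : Set where
    var : Fin k → Expr k
    𝟎   : Expr k
    _⊞_ : Expr k → Expr k → Expr k

  ⟦_⟧ : Expr k → Vec (F n) k → F n
  ⟦ var i ⟧ ρ = lookup ρ i
  ⟦ 𝟎 ⟧     ρ = 𝟘
  ⟦ e ⊞ e' ⟧ ρ = ⟦ e ⟧ ρ ⊕ ⟦ e' ⟧ ρ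

  indicator : Fin k → Vec Bool k
  indicator zero    = true ∷ 𝟘
  indicator (suc i) = false ∷ indicator i

  -- In an elementary abelian 2-group an expression is determined by the set of
  -- variables occurring in it an odd number of times.
  normalise : Expr k → Vec Bool k
  normalise (var i)  = indicator i
  normalise 𝟎        = 𝟘
  normalise (e ⊞ e') = normalise e ⊕ normalise e'

  ⟦_⟧↓ : Vec Bool k → Vec (F n) k → F n
  ⟦ [] ⟧↓     []      = 𝟘
  ⟦ b ∷ bs ⟧↓ (x ∷ ρ) = b · x ⊕ ⟦ bs ⟧↓ ρ

  ⟦𝟘⟧↓ : (ρ : Vec (F n) k) → ⟦ 𝟘 ⟧↓ ρ ≡ 𝟘
  ⟦𝟘⟧↓ []      = refl
  ⟦𝟘⟧↓ (x ∷ ρ) = trans (⊕-identityˡ _) (⟦𝟘⟧↓ ρ)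

  ⟦indicator⟧↓ : (i : Fin k) (ρ : Vec (F n) k) → ⟦ indicator i ⟧↓ ρ ≡ lookup ρ i
  ⟦indicator⟧↓ zero    (x ∷ ρ) = trans (cong (x ⊕_) (⟦𝟘⟧↓ ρ)) (⊕-identityʳ x)
  ⟦indicator⟧↓ (suc i) (x ∷ ρ) = trans (⊕-identityˡ _) (⟦indicator⟧↓ i ρ)

  ⟦⊕⟧↓ : (bs cs : Vec Bool k) (ρ : Vec (F n) k) → ⟦ bs ⊕ cs ⟧↓ ρ ≡ ⟦ bs ⟧↓ ρ ⊕ ⟦ cs ⟧↓ ρ
  ⟦⊕⟧↓ []       []       []      = sym (⊕-identityˡ 𝟘)
  ⟦⊕⟧↓ (b ∷ bs) (c ∷ cs) (x ∷ ρ) = begin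
    (b xor c) · x ⊕ ⟦ bs ⊕ cs ⟧↓ ρ          ≡⟨ cong₂ _⊕_ (·-distribʳ-xor b c x) (⟦⊕⟧↓ bs cs ρ) ⟩
    (b · x ⊕ c · x) ⊕ (⟦ bs ⟧↓ ρ ⊕ ⟦ cs ⟧↓ ρ) ≡⟨ ⊕-interchange (b · x) (c · x) _ _ ⟩
    (b · x ⊕ ⟦ bs ⟧↓ ρ) ⊕ (c · x ⊕ ⟦ cs ⟧↓ ρ) ∎

  normalise-correct : (e : Expr k) (ρ : Vec (F n) k) → ⟦ e ⟧ ρ ≡ ⟦ normalise e ⟧↓ ρ
  normalise-correct (var i)  ρ = sym (⟦indicator⟧↓ i ρ)
  normalise-correct 𝟎        ρ = sym (⟦𝟘⟧↓ ρ)
  normalise-correct (e ⊞ e') ρ =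
    trans (cong₂ _⊕_ (normalise-correct e ρ) (normalise-correct e' ρ))
          (sym (⟦⊕⟧↓ (normalise e) (normalise e') ρ))

  solve : (e e' : Expr k) → normalise e ≡ normalise e' → (ρ : Vec (F n) k) → ⟦ e ⟧ ρ ≡ ⟦ e' ⟧ ρ
  solve e e' same ρ =
    trans (normalise-correct e ρ) (trans (cong (λ bs → ⟦ bs ⟧↓ ρ) same) (sym (normalise-correct e' ρ)))

  v₀ : Expr (1 + k)
  v₀ = var zero
  v₁ : Expr (2 + k)
  v₁ = var (suc zero)
  v₂ : Expr (3 + k)
  v₂ = var (suc (suc zero))
  v₃ : Expr (4 + k)
  v₃ = var (suc (suc (suc zero)))
  v₄ : Expr (5 + k)
  v₄ = var (suc (suc (suc (suc zero))))
  v₅ : Expr (6 + k)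
  v₅ = var (suc (suc (suc (suc (suc zero)))))

open ⊕-Solver using (solve; 𝟎; _⊞_; v₀; v₁; v₂; v₃; v₄; v₅)

⊕-cancelˡ : (x : F n) {y z : F n} → x ⊕ y ≡ x ⊕ z → y ≡ z
⊕-cancelˡ x {y} {z} e = begin
  y            ≡⟨ solve v₁ (v₀ ⊞ (v₀ ⊞ v₁)) refl (x ∷ y ∷ []) ⟩
  x ⊕ (x ⊕ y)  ≡⟨ cong (x ⊕_) e ⟩
  x ⊕ (x ⊕ z)  ≡⟨ solve (v₀ ⊞ (v₀ ⊞ v₁)) v₁ refl (x ∷ z ∷ []) ⟩
  z            ∎

⊕-cancelʳ : {x y : F n} (z : F n) → x ⊕ z ≡ y ⊕ z → x ≡ y
⊕-cancelʳ {x = x} {y} z e = ⊕-cancelˡ z (trans (⊕-comm z x) (trans e (⊕-comm y z)))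

⊕≡𝟘⇒≡ : {x y : F n} → x ⊕ y ≡ 𝟘 → x ≡ y
⊕≡𝟘⇒≡ {y = y} e = ⊕-cancelʳ y (trans e (sym (⊕-self y)))

≡⇒⊕≡𝟘 : {x y : F n} → x ≡ y → x ⊕ y ≡ 𝟘
≡⇒⊕≡𝟘 {x = x} refl = ⊕-self x

≡⊕⇒⊕≡𝟘 : {x y z : F n} → x ≡ y ⊕ z → x ⊕ y ⊕ z ≡ 𝟘
≡⊕⇒⊕≡𝟘 {y = y} {z} refl = trans (⊕-assoc (y ⊕ z) y z) (≡⇒⊕≡𝟘 (solve (v₀ ⊞ v₁) (v₀ ⊞ v₁) refl (y ∷ z ∷ [])))

≡⊕⇒≡⊕ : {x y z : F n} → x ≡ y ⊕ z → z ≡ y ⊕ x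
≡⊕⇒≡⊕ {y = y} {z} refl = solve v₁ (v₀ ⊞ (v₀ ⊞ v₁)) refl (y ∷ z ∷ [])

≡⊕⇒≡𝟘 : {x y : F n} → x ≡ y ⊕ x → y ≡ 𝟘
≡⊕⇒≡𝟘 {x = x} {y} e = ⊕-cancelʳ x (trans (sym e) (sym (⊕-identityˡ x)))

≢𝟘⇒∃true : (x : F n) → x ≢ 𝟘 → ∃ λ i → lookup x i ≡ true
≢𝟘⇒∃true []          x≢𝟘 = contradiction refl x≢𝟘
≢𝟘⇒∃true (true ∷ x)  _   = zero , refl
≢𝟘⇒∃true (false ∷ x) x≢𝟘 =
  let i , xᵢ≡true = ≢𝟘⇒∃true x (x≢𝟘 ∘ cong (false ∷_)) in suc i , xᵢ≡true

+W-comm : (p q : W n) → p +W q ≡ q +W p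
+W-comm (x , a) (y , b) = cong₂ _,_ (⊕-comm x y) (xor-comm a b)

+W-cancelˡ : (p q : W n) → p +W (p +W q) ≡ q
+W-cancelˡ (x , a) (y , b) =
  cong₂ _,_ (solve (v₀ ⊞ (v₀ ⊞ v₁)) v₁ refl (x ∷ y ∷ []))
            (trans (sym (xor-assoc a a b)) (cong (_xor b) (xor-same a)))

+W-identityʳ : (p : W n) → p +W 𝟘W ≡ p
+W-identityʳ (x , a) = cong₂ _,_ (⊕-identityʳ x) (xor-identityʳ a)

+W≡𝟘⇒≡ : {p q : W n} → p +W q ≡ 𝟘W → p ≡ q
+W≡𝟘⇒≡ {p = x , a} {y , b} e = cong₂ _,_ (⊕≡𝟘⇒≡ (cong proj₁ e)) (xor≡false⇒≡ a b (cong proj₂ e))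
  where
  xor≡false⇒≡ : ∀ a b → a xor b ≡ false → a ≡ b
  xor≡false⇒≡ true  true  _ = refl
  xor≡false⇒≡ false b     e = sym e

_∈⟨_,_⟩ : W n → W n → W n → Set
r ∈⟨ p , q ⟩ = r ≡ p ⊎ r ≡ q ⊎ r ≡ p +W q

SameSpan : W n → W n → W n → W n → Set
SameSpan {n} p q p' q' = (r : W n) → r ∈⟨ p , q ⟩ ⇔ r ∈⟨ p' , q' ⟩

SameSpan-trans : {p q p' q' p'' q'' : W n} →
                 SameSpan p q p' q' → SameSpan p' q' p'' q'' → SameSpan p q p'' q''
SameSpan-trans S S' r = ⇔.trans (S r) (S' r)

SameSpan-sym : {p q p' q' : W n} → SameSpan p q p' q' → SameSpan p' q' p q
SameSpan-sym S r = ⇔.sym (S r)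

∈⟨⟩-swap : {p q r : W n} → r ∈⟨ p , q ⟩ → r ∈⟨ q , p ⟩
∈⟨⟩-swap                 (inj₁ r≡p)          = inj₂ (inj₁ r≡p)
∈⟨⟩-swap                 (inj₂ (inj₁ r≡q))   = inj₁ r≡q
∈⟨⟩-swap {p = p} {q = q} (inj₂ (inj₂ r≡p+q)) = inj₂ (inj₂ (trans r≡p+q (+W-comm p q)))

span-swap : (p q : W n) → SameSpan p q q p
span-swap p q r = mk⇔ ∈⟨⟩-swap ∈⟨⟩-swap

span-shift : (p q : W n) → SameSpan p q p (p +W q)
span-shift p q r = mk⇔ shift unshift
  where
  shift : r ∈⟨ p , q ⟩ → r ∈⟨ p , p +W q ⟩
  shift (inj₁ r≡p)          = inj₁ r≡p
  shift (inj₂ (inj₁ r≡q))   = inj₂ (inj₂ (trans r≡q (sym (+W-cancelˡ p q))))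
  shift (inj₂ (inj₂ r≡p+q)) = inj₂ (inj₁ r≡p+q)
  unshift : r ∈⟨ p , p +W q ⟩ → r ∈⟨ p , q ⟩
  unshift (inj₁ r≡p)               = inj₁ r≡p
  unshift (inj₂ (inj₁ r≡p+q))      = inj₂ (inj₂ r≡p+q)
  unshift (inj₂ (inj₂ r≡p+[p+q]))  = inj₂ (inj₁ (trans r≡p+[p+q] (+W-cancelˡ p q)))

∈L⇒≢𝟘 : (ℓ : Line n) {p : W n} → p ∈L ℓ → p ≢ 𝟘W
∈L⇒≢𝟘 ℓ (inj₁ refl)        = u≢0 ℓ
∈L⇒≢𝟘 ℓ (inj₂ (inj₁ refl)) = v≢0 ℓ
∈L⇒≢𝟘 ℓ (inj₂ (inj₂ refl)) = u≢v ℓ ∘ +W≡𝟘⇒≡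

Fin-injective⇒surjective : (g : Fin N → Fin N) → Injective _≡_ _≡_ g → ∀ c → ∃ λ i → g i ≡ c
Fin-injective⇒surjective {suc N} g g-injective c with any? (λ i → g i Fin.≟ c)
... | yes found = found
... | no ¬found = contradiction (injective⇒≤ punchOut-c-injective) 1+n≰n
  where
  c≢g : ∀ i → c ≢ g i
  c≢g i c≡gi = ¬found (i , sym c≡gi)
  punchOut-c-injective : Injective _≡_ _≡_ (λ i → punchOut (c≢g i))
  punchOut-c-injective {i} {j} e = g-injective (punchOut-injective (c≢g i) (c≢g j) e)

↔Fin-injective⇒surjective : A ↔ Fin N → (g : A → A) → Injective _≡_ _≡_ g → ∀ c → ∃ λ a → g a ≡ c
↔Fin-injective⇒surjective A↔Fin g g-injective c =
  let i , gᵢ≡c = Fin-injective⇒surjective (to ∘ g ∘ from) conj-injective (to c)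
  in from i , to-injective gᵢ≡c
  where
  open Inverse A↔Fin
  to-injective : Injective _≡_ _≡_ to
  to-injective {x} {y} e = trans (sym (strictlyInverseʳ x)) (trans (cong from e) (strictlyInverseʳ y))
  conj-injective : Injective _≡_ _≡_ (to ∘ g ∘ from)
  conj-injective {i} {j} e =
    trans (sym (strictlyInverseˡ i)) (trans (cong to (g-injective (to-injective e))) (strictlyInverseˡ j))

F↔Fin : F n ↔ Fin (2 ^ n)
F↔Fin {n} = ↔-trans (↔-sym (↔Vec n)) (↔-trans (lift↔ n (↔-sym 2↔Bool)) (↔-sym (Fin[m^n]↔Fin[m]^n 2 n)))

F-injective⇒surjective : (g : F n → F n) → Injective _≡_ _≡_ g → ∀ c → ∃ λ y → g y ≡ c
F-injective⇒surjective = ↔Fin-injective⇒surjective F↔Fin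

-- For p = (x, 0) choose i with xᵢ = 1: of q and p + q exactly one has its last
-- coordinate equal to the i-th coordinate of its first one.

coset-transversal : {p : W n} → p ≢ 𝟘W →
  ∃ λ (s : F n → W n) → Injective _≡_ _≡_ s × (∀ y y' → s y' ≢ p +W s y)
coset-transversal {p = x , true} _ = (λ y → y , true) , cong proj₁ , λ _ _ ()
coset-transversal {p = x , false} p≢𝟘 =
  let i , xᵢ≡true = ≢𝟘⇒∃true x (p≢𝟘 ∘ cong (_, false)) in
  (λ y → y , lookup y i) , cong proj₁ , avoids i xᵢ≡true
  where
  avoids : ∀ i → lookup x i ≡ true → ∀ y y' → (y' , lookup y' i) ≢ (x ⊕ y , lookup y i)
  avoids i xᵢ≡true y y' e = not-¬ refl (begin
    lookup y i                 ≡⟨ sym (cong proj₂ e) ⟩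
    lookup y' i                ≡⟨ cong (λ z → lookup z i) (cong proj₁ e) ⟩
    lookup (x ⊕ y) i           ≡⟨ lookup-zipWith _xor_ i x y ⟩
    lookup x i xor lookup y i  ≡⟨ cong (_xor lookup y i) xᵢ≡true ⟩
    not (lookup y i)           ∎)

-- The form c_f for an arbitrary f

Δ : (F n → F n) → F n → F n → F n
Δ f a x = f x ⊕ f (x ⊕ a)

Δ-𝟘 : (f : F n → F n) → f 𝟘 ≡ 𝟘 → (a : F n) → Δ f a 𝟘 ≡ f a
Δ-𝟘 f f𝟘≡𝟘 a = trans (cong₂ (λ s t → s ⊕ f t) f𝟘≡𝟘 (⊕-identityˡ a)) (⊕-identityˡ (f a))

cf-comm : (f : F n → F n) (p q : W n) → cf f p q ≡ cf f q p
cf-comm f (x , a) (y , b) = begin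
  f (x ⊕ y) ⊕ f x ⊕ f y ⊕ f (a · y ⊕ b · x)  ≡⟨ solve (v₀ ⊞ v₁ ⊞ v₂ ⊞ v₃) (v₀ ⊞ v₂ ⊞ v₁ ⊞ v₃) refl
                                                  (f (x ⊕ y) ∷ f x ∷ f y ∷ f (a · y ⊕ b · x) ∷ []) ⟩
  f (x ⊕ y) ⊕ f y ⊕ f x ⊕ f (a · y ⊕ b · x)  ≡⟨ cong₂ (λ s t → f s ⊕ f y ⊕ f x ⊕ f t)
                                                  (⊕-comm x y) (⊕-comm (a · y) (b · x)) ⟩
  f (y ⊕ x) ⊕ f y ⊕ f x ⊕ f (b · x ⊕ a · y)  ∎

cf-shift : (f : F n → F n) (p q : W n) → cf f p (p +W q) ≡ cf f p q
cf-shift f (x , a) (y , b) = begin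
  f (x ⊕ (x ⊕ y)) ⊕ f x ⊕ f (x ⊕ y) ⊕ f (a · (x ⊕ y) ⊕ (a xor b) · x)
    ≡⟨ cong₂ (λ s t → f s ⊕ f x ⊕ f (x ⊕ y) ⊕ f t)
         (solve (v₀ ⊞ (v₀ ⊞ v₁)) v₁ refl (x ∷ y ∷ [])) (scalars a b) ⟩
  f y ⊕ f x ⊕ f (x ⊕ y) ⊕ f (a · y ⊕ b · x)
    ≡⟨ solve (v₀ ⊞ v₁ ⊞ v₂ ⊞ v₃) (v₂ ⊞ v₁ ⊞ v₀ ⊞ v₃) refl
         (f y ∷ f x ∷ f (x ⊕ y) ∷ f (a · y ⊕ b · x) ∷ []) ⟩
  f (x ⊕ y) ⊕ f x ⊕ f y ⊕ f (a · y ⊕ b · x)  ∎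
  where
  scalars : ∀ a b → a · (x ⊕ y) ⊕ (a xor b) · x ≡ a · y ⊕ b · x
  scalars false b = refl
  scalars true false = solve (v₀ ⊞ v₁ ⊞ v₀) (v₁ ⊞ 𝟎) refl (x ∷ y ∷ [])
  scalars true true  = solve (v₀ ⊞ v₁ ⊞ 𝟎) (v₁ ⊞ v₀) refl (x ∷ y ∷ [])

cf-𝟘ʳ : (f : F n → F n) (p : W n) → cf f p 𝟘W ≡ 𝟘
cf-𝟘ʳ f (x , a) = begin
  f (x ⊕ 𝟘) ⊕ f x ⊕ f 𝟘 ⊕ f (a · 𝟘 ⊕ 𝟘)  ≡⟨ cong₂ (λ s t → f s ⊕ f x ⊕ f 𝟘 ⊕ f t)
                                              (⊕-identityʳ x) (trans (⊕-identityʳ (a · 𝟘)) (·-zeroʳ a)) ⟩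
  f x ⊕ f x ⊕ f 𝟘 ⊕ f 𝟘                  ≡⟨ solve (v₀ ⊞ v₀ ⊞ v₁ ⊞ v₁) 𝟎 refl (f x ∷ f 𝟘 ∷ []) ⟩
  𝟘                                      ∎
  where
  ·-zeroʳ : ∀ a → a · 𝟘 ≡ 𝟘 {n}
  ·-zeroʳ true  = refl
  ·-zeroʳ false = refl

cf-diag : (f : F n → F n) (p : W n) → cf f p p ≡ 𝟘
cf-diag f p = begin
  cf f p p           ≡⟨ cong (cf f p) (sym (+W-identityʳ p)) ⟩
  cf f p (p +W 𝟘W)   ≡⟨ cf-shift f p 𝟘W ⟩
  cf f p 𝟘W          ≡⟨ cf-𝟘ʳ f p ⟩
  𝟘                  ∎

cf-true : (f : F n → F n) (x y : F n) (b : Bool) →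
          cf f (x , true) (y , b) ≡ f x ⊕ f (if b then y else x ⊕ y)
cf-true f x y true = begin
  f (x ⊕ y) ⊕ f x ⊕ f y ⊕ f (y ⊕ x)  ≡⟨ cong (λ t → f (x ⊕ y) ⊕ f x ⊕ f y ⊕ f t) (⊕-comm y x) ⟩
  f (x ⊕ y) ⊕ f x ⊕ f y ⊕ f (x ⊕ y)  ≡⟨ solve (v₀ ⊞ v₁ ⊞ v₂ ⊞ v₀) (v₁ ⊞ v₂) refl (f (x ⊕ y) ∷ f x ∷ f y ∷ []) ⟩
  f x ⊕ f y                          ∎
cf-true f x y false = begin
  f (x ⊕ y) ⊕ f x ⊕ f y ⊕ f (y ⊕ 𝟘)  ≡⟨ cong (λ t → f (x ⊕ y) ⊕ f x ⊕ f y ⊕ f t) (⊕-identityʳ y) ⟩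
  f (x ⊕ y) ⊕ f x ⊕ f y ⊕ f y        ≡⟨ solve (v₀ ⊞ v₁ ⊞ v₂ ⊞ v₂) (v₁ ⊞ v₀) refl (f (x ⊕ y) ∷ f x ∷ f y ∷ []) ⟩
  f x ⊕ f (x ⊕ y)                    ∎

cf-false : (f : F n → F n) → f 𝟘 ≡ 𝟘 → (x y : F n) (b : Bool) →
           cf f (x , false) (y , b) ≡ (if b then Δ f x y else Δ f x y ⊕ f x)
cf-false f _ x y true = begin
  f (x ⊕ y) ⊕ f x ⊕ f y ⊕ f (𝟘 ⊕ x)  ≡⟨ cong₂ (λ s t → f s ⊕ f x ⊕ f y ⊕ f t) (⊕-comm x y) (⊕-identityˡ x) ⟩
  f (y ⊕ x) ⊕ f x ⊕ f y ⊕ f x        ≡⟨ solve (v₀ ⊞ v₁ ⊞ v₂ ⊞ v₁) (v₂ ⊞ v₀) refl (f (y ⊕ x) ∷ f x ∷ f y ∷ []) ⟩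
  f y ⊕ f (y ⊕ x)                    ∎
cf-false f f𝟘≡𝟘 x y false = begin
  f (x ⊕ y) ⊕ f x ⊕ f y ⊕ f (𝟘 ⊕ 𝟘)  ≡⟨ cong₂ (λ s t → f s ⊕ f x ⊕ f y ⊕ t)
                                          (⊕-comm x y) (trans (cong f (⊕-identityˡ 𝟘)) f𝟘≡𝟘) ⟩
  f (y ⊕ x) ⊕ f x ⊕ f y ⊕ 𝟘          ≡⟨ solve (v₀ ⊞ v₁ ⊞ v₂ ⊞ 𝟎) (v₂ ⊞ v₀ ⊞ v₁) refl (f (y ⊕ x) ∷ f x ∷ f y ∷ []) ⟩
  f y ⊕ f (y ⊕ x) ⊕ f x              ∎

fibre-true : (x y y' : F n) (b b' : Bool) →
             (if b then y else x ⊕ y) ≡ (if b' then y' else x ⊕ y') →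
             (y' , b') ≡ (y , b) ⊎ (y' , b') ≡ (x , true) +W (y , b)
fibre-true x y y' true  true  y≡y'       = inj₁ (cong (_, true) (sym y≡y'))
fibre-true x y y' true  false y≡x+y'     = inj₂ (cong (_, false) (≡⊕⇒≡⊕ y≡x+y'))
fibre-true x y y' false true  x+y≡y'     = inj₂ (cong (_, true) (sym x+y≡y'))
fibre-true x y y' false false x+y≡x+y'   = inj₁ (cong (_, false) (sym (⊕-cancelˡ x x+y≡x+y')))

span-rebase : (f : F n → F n) {u v r : W n} → r ∈⟨ u , v ⟩ →
              ∃ λ q → SameSpan r q u v × cf f r q ≡ cf f u v
span-rebase f {u} {v} (inj₁ refl)        = v , (λ _ → ⇔.refl) , refl
span-rebase f {u} {v} (inj₂ (inj₁ refl)) = u , span-swap v u , cf-comm f v u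
span-rebase f {u} {v} (inj₂ (inj₂ refl)) =
  u , SameSpan-trans (span-swap (u +W v) u) (SameSpan-sym (span-shift u v)) ,
  trans (cf-comm f (u +W v) u) (cf-shift f u v)

cf-span : (f : F n → F n) {p q r : W n} → r ∈⟨ p , q ⟩ → r ≢ p → cf f p r ≡ cf f p q
cf-span f (inj₁ r≡p)        r≢p = contradiction r≡p r≢p
cf-span f (inj₂ (inj₁ refl)) _  = refl
cf-span f (inj₂ (inj₂ refl)) _  = cf-shift f _ _

cfL-SameLine : (f : F n → F n) (ℓ ℓ' : Line n) → SameLine ℓ ℓ' → cfL f ℓ ≡ cfL f ℓ'
cfL-SameLine f ℓ ℓ' same =
  let q , span≈ , cf≡cfL = span-rebase f (Equivalence.from (same (u ℓ')) (inj₁ refl))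
      v'∈span = Equivalence.from (span≈ (v ℓ')) (Equivalence.from (same (v ℓ')) (inj₂ (inj₁ refl)))
  in sym (trans (cf-span f v'∈span (u≢v ℓ' ∘ sym)) cf≡cfL)

-- Consequences of crookedness

module CrookedProperties {f : F n → F n} (crooked : Crooked f) where

  f𝟘≡𝟘 : f 𝟘 ≡ 𝟘
  f𝟘≡𝟘 = proj₁ crooked

  Δ-sum₃≢𝟘 : {a : F n} → a ≢ 𝟘 → (x y z : F n) → Δ f a x ⊕ Δ f a y ⊕ Δ f a z ≢ 𝟘
  Δ-sum₃≢𝟘 {a} a≢𝟘 x y z sum≡𝟘 = proj₂ (proj₂ crooked) a x y z a≢𝟘 (begin
    f x ⊕ f y ⊕ f z ⊕ f (x ⊕ a) ⊕ f (y ⊕ a) ⊕ f (z ⊕ a)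
      ≡⟨ solve (v₀ ⊞ v₂ ⊞ v₄ ⊞ v₁ ⊞ v₃ ⊞ v₅) (v₀ ⊞ v₁ ⊞ (v₂ ⊞ v₃) ⊞ (v₄ ⊞ v₅)) refl
           (f x ∷ f (x ⊕ a) ∷ f y ∷ f (y ⊕ a) ∷ f z ∷ f (z ⊕ a) ∷ []) ⟩
    Δ f a x ⊕ Δ f a y ⊕ Δ f a z
      ≡⟨ sum≡𝟘 ⟩
    𝟘 ∎)

  Δ≢𝟘 : {a : F n} → a ≢ 𝟘 → (x : F n) → Δ f a x ≢ 𝟘
  Δ≢𝟘 a≢𝟘 x Δ≡𝟘 = Δ-sum₃≢𝟘 a≢𝟘 x x x
    (trans (solve (v₀ ⊞ v₀ ⊞ v₀) v₀ refl (Δ f _ x ∷ [])) Δ≡𝟘)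

  f-injective : Injective _≡_ _≡_ f
  f-injective {x} {y} fx≡fy with x ≟ y
  ... | yes x≡y = x≡y
  ... | no  x≢y = contradiction (≡⇒⊕≡𝟘 (trans fx≡fy (cong f (sym x+[x+y]≡y))))
                                (Δ≢𝟘 (x≢y ∘ ⊕≡𝟘⇒≡) x)
    where
    x+[x+y]≡y : x ⊕ (x ⊕ y) ≡ y
    x+[x+y]≡y = solve (v₀ ⊞ (v₀ ⊞ v₁)) v₁ refl (x ∷ y ∷ [])

  Δ-2to1 : {a y y' : F n} → a ≢ 𝟘 → Δ f a y ≡ Δ f a y' → y' ≡ y ⊎ y' ≡ y ⊕ a
  Δ-2to1 {a} {y} {y'} a≢𝟘 Δy≡Δy' with y' ≟ y | y' ≟ y ⊕ a
  ... | yes y'≡y | _            = inj₁ y'≡y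
  ... | no _     | yes y'≡y+a   = inj₂ y'≡y+a
  ... | no y'≢y  | no  y'≢y+a   = ⊥-elim (
    proj₁ (proj₂ crooked) y (y ⊕ a) y' (λ y≡y+a → a≢𝟘 (≡⊕⇒≡𝟘 (trans y≡y+a (⊕-comm y a))))
      (y'≢y ∘ sym) (y'≢y+a ∘ sym) (begin
        f y ⊕ f (y ⊕ a) ⊕ f y' ⊕ f (y ⊕ (y ⊕ a) ⊕ y')
          ≡⟨ cong (λ t → f y ⊕ f (y ⊕ a) ⊕ f y' ⊕ f t)
               (solve (v₀ ⊞ (v₀ ⊞ v₁) ⊞ v₂) (v₂ ⊞ v₁) refl (y ∷ a ∷ y' ∷ [])) ⟩
        f y ⊕ f (y ⊕ a) ⊕ f y' ⊕ f (y' ⊕ a)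
          ≡⟨ ⊕-assoc (Δ f a y) (f y') (f (y' ⊕ a)) ⟩
        Δ f a y ⊕ Δ f a y'
          ≡⟨ ≡⇒⊕≡𝟘 Δy≡Δy' ⟩
        𝟘 ∎))

  Δ-fibre : {x : F n} → x ≢ 𝟘 → (y y' : F n) (b : Bool) → Δ f x y ≡ Δ f x y' →
            (y' , b) ≡ (y , b) ⊎ (y' , b) ≡ (x , false) +W (y , b)
  Δ-fibre {x} x≢𝟘 y y' b Δy≡Δy' with Δ-2to1 x≢𝟘 Δy≡Δy'
  ... | inj₁ y'≡y   = inj₁ (cong (_, b) y'≡y)
  ... | inj₂ y'≡y+x = inj₂ (cong (_, b) (trans y'≡y+x (⊕-comm y x)))

  Δ≢Δ⊕f : {x : F n} → x ≢ 𝟘 → (y y' : F n) → Δ f x y ≢ Δ f x y' ⊕ f x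
  Δ≢Δ⊕f {x} x≢𝟘 y y' e =
    Δ-sum₃≢𝟘 x≢𝟘 y y' 𝟘 (≡⊕⇒⊕≡𝟘 (trans e (cong (Δ f x y' ⊕_) (sym (Δ-𝟘 f f𝟘≡𝟘 x)))))

  fibre-false : {x : F n} → x ≢ 𝟘 → (y y' : F n) (b b' : Bool) →
                (if b then Δ f x y else Δ f x y ⊕ f x) ≡ (if b' then Δ f x y' else Δ f x y' ⊕ f x) →
                (y' , b') ≡ (y , b) ⊎ (y' , b') ≡ (x , false) +W (y , b)
  fibre-false x≢𝟘 y y' true  true  e = Δ-fibre x≢𝟘 y y' true e
  fibre-false x≢𝟘 y y' false false e = Δ-fibre x≢𝟘 y y' false (⊕-cancelʳ _ e)
  fibre-false x≢𝟘 y y' true  false e = ⊥-elim (Δ≢Δ⊕f x≢𝟘 y y' e)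
  fibre-false x≢𝟘 y y' false true  e = ⊥-elim (Δ≢Δ⊕f x≢𝟘 y' y (sym e))

  cf-fibre : {p q q' : W n} → p ≢ 𝟘W → cf f p q ≡ cf f p q' → q' ≡ q ⊎ q' ≡ p +W q
  cf-fibre {x , true} {y , b} {y' , b'} _ e =
    fibre-true x y y' b b' (f-injective (⊕-cancelˡ (f x) (begin
      f x ⊕ f (if b then y else x ⊕ y)    ≡⟨ sym (cf-true f x y b) ⟩
      cf f (x , true) (y , b)             ≡⟨ e ⟩
      cf f (x , true) (y' , b')           ≡⟨ cf-true f x y' b' ⟩
      f x ⊕ f (if b' then y' else x ⊕ y') ∎)))
  cf-fibre {x , false} {y , b} {y' , b'} p≢𝟘 e =
    fibre-false (p≢𝟘 ∘ cong (_, false)) y y' b b'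
      (trans (sym (cf-false f f𝟘≡𝟘 x y b)) (trans e (cf-false f f𝟘≡𝟘 x y' b')))

  cf≢𝟘 : {p q : W n} → p ≢ 𝟘W → q ≢ 𝟘W → p ≢ q → cf f p q ≢ 𝟘
  cf≢𝟘 {p} p≢𝟘 q≢𝟘 p≢q cf≡𝟘 with cf-fibre p≢𝟘 (trans cf≡𝟘 (sym (cf-𝟘ʳ f p)))
  ... | inj₁ 𝟘≡q   = q≢𝟘 (sym 𝟘≡q)
  ... | inj₂ 𝟘≡p+q = p≢q (+W≡𝟘⇒≡ (sym 𝟘≡p+q))

  cf-cover : {p : W n} {c : F n} → p ≢ 𝟘W → c ≢ 𝟘 → ∃ λ q → q ≢ 𝟘W × p ≢ q × cf f p q ≡ c
  cf-cover {p} {c} p≢𝟘 c≢𝟘 =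
    let s , s-injective , s-avoids = coset-transversal p≢𝟘
        y , cf≡c = F-injective⇒surjective (cf f p ∘ s) (cf-injective s-injective s-avoids) c
    in s y , (λ s≡𝟘 → c≢𝟘 (trans (sym cf≡c) (trans (cong (cf f p) s≡𝟘) (cf-𝟘ʳ f p)))) ,
             (λ p≡s → c≢𝟘 (trans (sym cf≡c) (trans (cong (cf f p) (sym p≡s)) (cf-diag f p)))) ,
             cf≡c
    where
    cf-injective : {s : F n → W n} → Injective _≡_ _≡_ s → (∀ y y' → s y' ≢ p +W s y) →
                   Injective _≡_ _≡_ (cf f p ∘ s)
    cf-injective s-injective s-avoids {y} {y'} e with cf-fibre p≢𝟘 e
    ... | inj₁ sy'≡sy   = sym (s-injective sy'≡sy)
    ... | inj₂ sy'≡p+sy = contradiction sy'≡p+sy (s-avoids y y')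

  Πf-unique : (c : F n) (ℓ ℓ' : Line n) → Πf f c ℓ → Πf f c ℓ' →
              (p : W n) → p ∈L ℓ → p ∈L ℓ' → SameLine ℓ ℓ'
  Πf-unique c ℓ ℓ' cfℓ≡c cfℓ'≡c p p∈ℓ p∈ℓ' =
    let q  , ⟨p,q⟩≈ℓ    , cf≡cfℓ  = span-rebase f p∈ℓ
        q' , ⟨p,q'⟩≈ℓ'  , cf≡cfℓ' = span-rebase f p∈ℓ'
        ⟨p,q⟩≈⟨p,q'⟩ = pair-span (cf-fibre (∈L⇒≢𝟘 ℓ p∈ℓ)
                         (trans cf≡cfℓ (trans cfℓ≡c (trans (sym cfℓ'≡c) (sym cf≡cfℓ')))))
    in SameSpan-trans (SameSpan-sym ⟨p,q⟩≈ℓ) (SameSpan-trans ⟨p,q⟩≈⟨p,q'⟩ ⟨p,q'⟩≈ℓ')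
    where
    pair-span : {q q' : W n} → q' ≡ q ⊎ q' ≡ p +W q → SameSpan p q p q'
    pair-span (inj₁ refl) _ = ⇔.refl
    pair-span {q} (inj₂ refl) = span-shift p q

theorem2 : (n : ℕ) → 1 ≤ n → (f : F n → F n) → Crooked f →
    ((ℓ : Line n) → cfL f ℓ ≢ 𝟘)
    × ((ℓ ℓ' : Line n) → SameLine ℓ ℓ' → cfL f ℓ ≡ cfL f ℓ')
    × IsLineParallelism (Πf f)
theorem2 n _ f crooked = cfL≢𝟘 , cfL-SameLine f , (spread , disjoint , covering)
  where
  open CrookedProperties crooked

  cfL≢𝟘 : (ℓ : Line n) → cfL f ℓ ≢ 𝟘
  cfL≢𝟘 ℓ = cf≢𝟘 (u≢0 ℓ) (v≢0 ℓ) (u≢v ℓ)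

  spread : (c : F n) → c ≢ 𝟘 → IsLineSpread (Πf f c)
  spread c c≢𝟘 = through , Πf-unique c
    where
    through : (p : W n) → IsPoint p → Σ (Line n) (λ ℓ → Πf f c ℓ × p ∈L ℓ)
    through p p≢𝟘 = let q , q≢𝟘 , p≢q , cf≡c = cf-cover p≢𝟘 c≢𝟘
                    in line p q p≢𝟘 q≢𝟘 p≢q , cf≡c , inj₁ refl

  disjoint : (c c' : F n) → c ≢ 𝟘 → c' ≢ 𝟘 → c ≢ c' → (ℓ : Line n) → Πf f c ℓ → Πf f c' ℓ → ⊥
  disjoint c c' _ _ c≢c' ℓ cfℓ≡c cfℓ≡c' = c≢c' (trans (sym cfℓ≡c) cfℓ≡c')

  covering : (ℓ : Line n) → Σ (F n) (λ c → c ≢ 𝟘 × Πf f c ℓ)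
  covering ℓ = cfL f ℓ , cfL≢𝟘 ℓ , refl
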